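{- Let $\{V_n\}_{n\ge 0}$ be the Fennessey-Larcombe-French sequence, defined by $V_0=1$, $V_1=8$ and, for $n\ge 2$, $$(n-1)n^2 V_n = 8(n-1)(3n^2-n-1)V_{n-1} - 128(n-2)n^2 V_{n-2}.$$ Then $\{V_n\}_{n\ge 1}$ is ratio log-convex, that is, for all integers $n\ge 3$, $$\left(\frac{V_n}{V_{n-1}}\right)^2 \le \frac{V_{n-1}}{V_{n-2}}\cdot\frac{V_{n+1}}{V_n}.$$
   Context: A real sequence $\{S_n\}$ is called ratio log-convex if the sequence of ratios $\{S_n/S_{n-1}\}$ is log-convex, i.e. $(S_n/S_{n-1})^2 \le (S_{n-1}/S_{n-2})(S_{n+1}/S_n)$. -}

module Defs where

open import Data.Nat using (ℕ; zero; suc)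
open import Data.Integer using (+_)
open import Data.Rational using (ℚ; _+_; _-_; _*_; _÷_; 0ℚ; 1ℚ; ≢-nonZero)
import Data.Rational as ℚ
open import Data.Rational.Properties using (_≟_)
open import Relation.Nullary using (yes; no)

⟦_⟧ : ℕ → ℚ
⟦ k ⟧ = ℚ._/_ (+ k) 1

-- total division on ℚ (x / 0 := 0); only ever applied to nonzero
-- denominators in the statement (the FLF terms are all nonzero).
_/'_ : ℚ → ℚ → ℚ
x /' y with y ≟ 0ℚ
... | yes _ = 0ℚ
... | no y≢0 = _÷_ x y {{≢-nonZero y≢0}}

V : ℕ → ℚ
V zero = 1ℚ
V (suc zero) = ⟦ 8 ⟧
V (suc (suc m)) =
  ( ⟦ 8 ⟧ * ⟦ suc m ⟧ * (⟦ 3 ⟧ * n * n - n - 1ℚ) * V (suc m)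
  - ⟦ 128 ⟧ * ⟦ m ⟧ * n * n * V m )
  /' (⟦ suc m ⟧ * n * n)
  where n = ⟦ suc (suc m) ⟧

-- Let ρ n = n⁴ and ℓ n = 16 n⁴ + 16 n + 48. From n = 4 on, the recurrence propagates the
-- lower bound ℓ n · V (n - 1) ≤ ρ n · V n on the ratios. Ratio log-convexity at n amounts to
-- V n ³ · V (n - 2) ≤ V (n - 1) ³ · V (n + 1). Eliminating V (n - 2) and V (n + 1) by the
-- recurrence and writing ρ n · V n = ℓ n · V (n - 1) + e with e ≥ 0, the difference, times a
-- positive weight, becomes a binary quartic in V (n - 1) and e whose coefficients are
-- polynomials in n. Each polynomial inequality needed holds for n ≥ 4 because p (4 + x) has
-- nonnegative coefficients, which the type checker confirms by normalising p. The case n = 3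
-- is a direct computation.

module Submission where

open import Defs
open import Data.Nat using (ℕ; _≤_; _∸_; suc)
open import Data.Rational using (_*_)
import Data.Rational as ℚ

open import Data.Integer using (+_)
import Data.Integer as ℤ
import Data.Integer.Tactic.RingSolver as ℤ-Solver
open import Data.List using (List; []; _∷_; map; length)
open import Data.List.Relation.Unary.All using (All; []; _∷_; all?)
import Data.List.Relation.Unary.All as All
import Data.List.Relation.Unary.All.Properties as All
import Data.Nat as ℕ
open import Data.Nat using (zero; s≤s)
open import Data.Product using (_×_; _,_; proj₁; proj₂)
open import Data.Rational
  using (ℚ; 0ℚ; 1ℚ; _+_; _-_; -_; _≤?_; _<?_; toℚᵘ; nonNegative; positive)
open import Data.Rational.Properties
open import Data.Rational.Unnormalised using (mkℚᵘ; *≡*)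
import Data.Rational.Unnormalised as ℚᵘ
import Data.Rational.Unnormalised.Properties as ℚᵘ
open import Level using (0ℓ)
open import Algebra.Definitions.RawSemiring ℚ.+-*-rawSemiring using (_^_)
open import Relation.Binary.PropositionalEquality
open import Relation.Nullary using (Dec; yes; no; contradiction)
open import Relation.Nullary.Decidable using (True; toWitness; from-yes; dec⇒maybe)
open import Tactic.RingSolver using (solve-∀)
open import Tactic.RingSolver.Core.AlmostCommutativeRing
  using (AlmostCommutativeRing; fromCommutativeRing)

ℚ-ring : AlmostCommutativeRing 0ℓ 0ℓ
ℚ-ring = fromCommutativeRing +-*-commutativeRing (λ x → dec⇒maybe (0ℚ ≟ x))

⟦+⟧ : ∀ m n → ⟦ m ℕ.+ n ⟧ ≡ ⟦ m ⟧ + ⟦ n ⟧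
⟦+⟧ m n = toℚᵘ-injective (begin
  toℚᵘ ⟦ m ℕ.+ n ⟧                ≈⟨ toℚᵘ-fromℚᵘ (mkℚᵘ (+ (m ℕ.+ n)) 0) ⟩
  mkℚᵘ (+ (m ℕ.+ n)) 0             ≈⟨ *≡* (lemma (+ m) (+ n)) ⟩
  mkℚᵘ (+ m) 0 ℚᵘ.+ mkℚᵘ (+ n) 0
    ≈⟨ ℚᵘ.+-cong (toℚᵘ-fromℚᵘ (mkℚᵘ (+ m) 0)) (toℚᵘ-fromℚᵘ (mkℚᵘ (+ n) 0)) ⟨
  toℚᵘ ⟦ m ⟧ ℚᵘ.+ toℚᵘ ⟦ n ⟧       ≈⟨ toℚᵘ-homo-+ ⟦ m ⟧ ⟦ n ⟧ ⟨
  toℚᵘ (⟦ m ⟧ + ⟦ n ⟧)             ∎)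
  where
  open ℚᵘ.≃-Reasoning
  lemma : ∀ i j → (i ℤ.+ j) ℤ.* (+ 1 ℤ.* + 1) ≡ (i ℤ.* + 1 ℤ.+ j ℤ.* + 1) ℤ.* + 1
  lemma = ℤ-Solver.solve-∀

⟦m+n⟧-⟦m⟧≡⟦n⟧ : ∀ m n → ⟦ m ℕ.+ n ⟧ - ⟦ m ⟧ ≡ ⟦ n ⟧
⟦m+n⟧-⟦m⟧≡⟦n⟧ m n = trans (cong (_- ⟦ m ⟧) (⟦+⟧ m n)) (lemma ⟦ m ⟧ ⟦ n ⟧)
  where
  lemma : ∀ x y → x + y - x ≡ y
  lemma = solve-∀ ℚ-ring

⟦⟧-nonNeg : ∀ n → 0ℚ ℚ.≤ ⟦ n ⟧
⟦⟧-nonNeg n = nonNegative⁻¹ ⟦ n ⟧ {{normalize-nonNeg n 1}}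

x/'y*y≡x : ∀ x {y} → 0ℚ ℚ.< y → (x /' y) * y ≡ x
x/'y*y≡x x {y} 0<y with y ≟ 0ℚ
... | yes y≡0 = contradiction (sym y≡0) (<⇒≢ 0<y)
... | no y≢0 = begin
  x * ℚ.1/ y * y     ≡⟨ *-assoc x (ℚ.1/ y) y ⟩
  x * (ℚ.1/ y * y)   ≡⟨ cong (x *_) (*-inverseˡ y) ⟩
  x * 1ℚ             ≡⟨ *-identityʳ x ⟩
  x                  ∎
  where
  open ≡-Reasoning
  instance _ = ℚ.≢-nonZero y≢0

+-nonNeg : ∀ {p q} → 0ℚ ℚ.≤ p → 0ℚ ℚ.≤ q → 0ℚ ℚ.≤ p + q
+-nonNeg = +-mono-≤

*-nonNeg : ∀ {p q} → 0ℚ ℚ.≤ p → 0ℚ ℚ.≤ q → 0ℚ ℚ.≤ p * q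
*-nonNeg {p} {q} 0≤p 0≤q =
  nonNegative⁻¹ (p * q) {{nonNeg*nonNeg⇒nonNeg p {{nonNegative 0≤p}} q {{nonNegative 0≤q}}}}

*-pos : ∀ {p q} → 0ℚ ℚ.< p → 0ℚ ℚ.< q → 0ℚ ℚ.< p * q
*-pos {p} {q} 0<p 0<q = positive⁻¹ (p * q) {{pos*pos⇒pos p {{positive 0<p}} q {{positive 0<q}}}}

*-cancelˡ-nonNeg : ∀ {p q} → 0ℚ ℚ.< p → 0ℚ ℚ.≤ p * q → 0ℚ ℚ.≤ q
*-cancelˡ-nonNeg {p} 0<p 0≤pq =
  *-cancelˡ-≤-pos p {{positive 0<p}} (≤-trans (≤-reflexive (*-zeroʳ p)) 0≤pq)

*-cancelˡ-pos : ∀ {p q} → 0ℚ ℚ.< p → 0ℚ ℚ.< p * q → 0ℚ ℚ.< q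
*-cancelˡ-pos {p} 0<p 0<pq =
  *-cancelˡ-<-nonNeg p {{nonNegative (<⇒≤ 0<p)}} (≤-<-trans (≤-reflexive (*-zeroʳ p)) 0<pq)

p≤q⇒0≤q-p : ∀ {p q} → p ℚ.≤ q → 0ℚ ℚ.≤ q - p
p≤q⇒0≤q-p {p} {q} p≤q = begin
  0ℚ      ≡⟨ +-inverseʳ p ⟨
  p - p   ≤⟨ +-monoˡ-≤ (- p) p≤q ⟩
  q - p   ∎
  where open ≤-Reasoning

0≤q-p⇒p≤q : ∀ {p q} → 0ℚ ℚ.≤ q - p → p ℚ.≤ q
0≤q-p⇒p≤q {p} {q} 0≤q-p = begin
  p            ≡⟨ +-identityˡ p ⟨
  0ℚ + p       ≤⟨ +-monoˡ-≤ p 0≤q-p ⟩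
  q - p + p    ≡⟨ lemma q p ⟩
  q            ∎
  where
  open ≤-Reasoning
  lemma : ∀ q p → q - p + p ≡ q
  lemma = solve-∀ ℚ-ring

-- Polynomials with nonnegativity certificates

infixl 6 _⊕_
infixl 7 _⊗_
infix 9 ⊖_
infix 8 _∘_
infix 9 #_
infixl 10 _⁺

data Poly : Set where
  X : Poly
  #_ : ℕ → Poly
  _⊕_ _⊗_ : Poly → Poly → Poly
  ⊖_ : Poly → Poly

eval : Poly → ℚ → ℚ
eval X t = t
eval (# k) t = ⟦ k ⟧
eval (p ⊕ q) t = eval p t + eval q t
eval (p ⊗ q) t = eval p t * eval q t
eval (⊖ p) t = - eval p t

_∘_ : Poly → Poly → Poly
X ∘ q = q
# k ∘ q = # k
(p₁ ⊕ p₂) ∘ q = p₁ ∘ q ⊕ p₂ ∘ q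
(p₁ ⊗ p₂) ∘ q = p₁ ∘ q ⊗ p₂ ∘ q
(⊖ p) ∘ q = ⊖ (p ∘ q)

eval-∘ : ∀ p q t → eval (p ∘ q) t ≡ eval p (eval q t)
eval-∘ X q t = refl
eval-∘ (# k) q t = refl
eval-∘ (p₁ ⊕ p₂) q t = cong₂ _+_ (eval-∘ p₁ q t) (eval-∘ p₂ q t)
eval-∘ (p₁ ⊗ p₂) q t = cong₂ _*_ (eval-∘ p₁ q t) (eval-∘ p₂ q t)
eval-∘ (⊖ p) q t = cong -_ (eval-∘ p q t)

_⁺ : Poly → Poly
p ⁺ = p ∘ (# 1 ⊕ X)

horner : List ℚ → ℚ → ℚ
horner [] t = 0ℚ
horner (c ∷ cs) t = c + t * horner cs t

infixl 6 _+ᶜ_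
infixl 7 _*ᶜ_

_+ᶜ_ : List ℚ → List ℚ → List ℚ
[] +ᶜ q = q
(a ∷ p) +ᶜ [] = a ∷ p
(a ∷ p) +ᶜ (b ∷ q) = a + b ∷ p +ᶜ q

_*ᶜ_ : List ℚ → List ℚ → List ℚ
[] *ᶜ q = []
(a ∷ p) *ᶜ q = map (a *_) q +ᶜ (0ℚ ∷ p *ᶜ q)

coeffs : Poly → List ℚ
coeffs X = 0ℚ ∷ 1ℚ ∷ []
coeffs (# k) = ⟦ k ⟧ ∷ []
coeffs (p ⊕ q) = coeffs p +ᶜ coeffs q
coeffs (p ⊗ q) = coeffs p *ᶜ coeffs q
coeffs (⊖ p) = map -_ (coeffs p)

horner-+ᶜ : ∀ p q t → horner (p +ᶜ q) t ≡ horner p t + horner q t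
horner-+ᶜ [] q t = sym (+-identityˡ (horner q t))
horner-+ᶜ (a ∷ p) [] t = sym (+-identityʳ (horner (a ∷ p) t))
horner-+ᶜ (a ∷ p) (b ∷ q) t =
  trans (cong (λ h → a + b + t * h) (horner-+ᶜ p q t)) (lemma a b t (horner p t) (horner q t))
  where
  lemma : ∀ a b t x y → a + b + t * (x + y) ≡ (a + t * x) + (b + t * y)
  lemma = solve-∀ ℚ-ring

horner-scale : ∀ c p t → horner (map (c *_) p) t ≡ c * horner p t
horner-scale c [] t = sym (*-zeroʳ c)
horner-scale c (a ∷ p) t =
  trans (cong (λ h → c * a + t * h) (horner-scale c p t)) (lemma c a t (horner p t))
  where
  lemma : ∀ c a t x → c * a + t * (c * x) ≡ c * (a + t * x)
  lemma = solve-∀ ℚ-ring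

horner-*ᶜ : ∀ p q t → horner (p *ᶜ q) t ≡ horner p t * horner q t
horner-*ᶜ [] q t = sym (*-zeroˡ (horner q t))
horner-*ᶜ (a ∷ p) q t = begin
  horner (map (a *_) q +ᶜ (0ℚ ∷ p *ᶜ q)) t
    ≡⟨ horner-+ᶜ (map (a *_) q) (0ℚ ∷ p *ᶜ q) t ⟩
  horner (map (a *_) q) t + (0ℚ + t * horner (p *ᶜ q) t)
    ≡⟨ cong₂ (λ x y → x + (0ℚ + t * y)) (horner-scale a q t) (horner-*ᶜ p q t) ⟩
  a * horner q t + (0ℚ + t * (horner p t * horner q t))
    ≡⟨ lemma a t (horner p t) (horner q t) ⟩
  (a + t * horner p t) * horner q t ∎
  where
  open ≡-Reasoning
  lemma : ∀ a t x y → a * y + (0ℚ + t * (x * y)) ≡ (a + t * x) * y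
  lemma = solve-∀ ℚ-ring

horner-neg : ∀ p t → horner (map -_ p) t ≡ - horner p t
horner-neg [] t = refl
horner-neg (a ∷ p) t = trans (cong (λ h → - a + t * h) (horner-neg p t)) (lemma a t (horner p t))
  where
  lemma : ∀ a t x → - a + t * (- x) ≡ - (a + t * x)
  lemma = solve-∀ ℚ-ring

eval≡horner-coeffs : ∀ p t → eval p t ≡ horner (coeffs p) t
eval≡horner-coeffs X t = lemma t
  where
  lemma : ∀ t → t ≡ 0ℚ + t * (1ℚ + t * 0ℚ)
  lemma = solve-∀ ℚ-ring
eval≡horner-coeffs (# k) t = lemma ⟦ k ⟧ t
  where
  lemma : ∀ c t → c ≡ c + t * 0ℚ
  lemma = solve-∀ ℚ-ring
eval≡horner-coeffs (p ⊕ q) t =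
  trans (cong₂ _+_ (eval≡horner-coeffs p t) (eval≡horner-coeffs q t))
        (sym (horner-+ᶜ (coeffs p) (coeffs q) t))
eval≡horner-coeffs (p ⊗ q) t =
  trans (cong₂ _*_ (eval≡horner-coeffs p t) (eval≡horner-coeffs q t))
        (sym (horner-*ᶜ (coeffs p) (coeffs q) t))
eval≡horner-coeffs (⊖ p) t =
  trans (cong -_ (eval≡horner-coeffs p t)) (sym (horner-neg (coeffs p) t))

horner-nonNeg : ∀ {cs} t → All (0ℚ ℚ.≤_) cs → 0ℚ ℚ.≤ t → 0ℚ ℚ.≤ horner cs t
horner-nonNeg t [] 0≤t = ≤-refl
horner-nonNeg t (0≤c ∷ 0≤cs) 0≤t = +-nonNeg 0≤c (*-nonNeg 0≤t (horner-nonNeg t 0≤cs 0≤t))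

NonNegCoeffsFrom : ℕ → Poly → Set
NonNegCoeffsFrom a p = All (0ℚ ℚ.≤_) (coeffs (p ∘ (# a ⊕ X)))

nonNegCoeffsFrom? : ∀ a p → Dec (NonNegCoeffsFrom a p)
nonNegCoeffsFrom? a p = all? (0ℚ ≤?_) (coeffs (p ∘ (# a ⊕ X)))

nonNegCoeffsFrom⇒nonNeg : ∀ a p → NonNegCoeffsFrom a p → ∀ k → 0ℚ ℚ.≤ eval p ⟦ a ℕ.+ k ⟧
nonNegCoeffsFrom⇒nonNeg a p nonNeg k =
  subst (0ℚ ℚ.≤_) shifted (horner-nonNeg ⟦ k ⟧ nonNeg (⟦⟧-nonNeg k))
  where
  open ≡-Reasoning
  shifted : horner (coeffs (p ∘ (# a ⊕ X))) ⟦ k ⟧ ≡ eval p ⟦ a ℕ.+ k ⟧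
  shifted = begin
    horner (coeffs (p ∘ (# a ⊕ X))) ⟦ k ⟧  ≡⟨ eval≡horner-coeffs (p ∘ (# a ⊕ X)) ⟦ k ⟧ ⟨
    eval (p ∘ (# a ⊕ X)) ⟦ k ⟧             ≡⟨ eval-∘ p (# a ⊕ X) ⟦ k ⟧ ⟩
    eval p (⟦ a ⟧ + ⟦ k ⟧)                 ≡⟨ cong (eval p) (⟦+⟧ a k) ⟨
    eval p ⟦ a ℕ.+ k ⟧                     ∎

nonNeg-beyond : ∀ a p {_ : True (nonNegCoeffsFrom? a p)} k → 0ℚ ℚ.≤ eval p ⟦ a ℕ.+ k ⟧
nonNeg-beyond a p {nonNeg} = nonNegCoeffsFrom⇒nonNeg a p (toWitness nonNeg)

pos-beyond : ∀ a p {_ : True (nonNegCoeffsFrom? a (p ⊕ ⊖ # 1))} k → 0ℚ ℚ.< eval p ⟦ a ℕ.+ k ⟧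
pos-beyond a p {nonNeg} k =
  <-≤-trans (positive⁻¹ 1ℚ) (0≤q-p⇒p≤q (nonNeg-beyond a (p ⊕ ⊖ # 1) {nonNeg} k))

all-nonNeg-beyond : ∀ a ps {_ : True (all? (nonNegCoeffsFrom? a) ps)} k →
                    All (λ p → 0ℚ ℚ.≤ eval p ⟦ a ℕ.+ k ⟧) ps
all-nonNeg-beyond a ps {nonNeg} k =
  All.map (λ {p} ok → nonNegCoeffsFrom⇒nonNeg a p ok k) (toWitness nonNeg)

-- Three-term recurrences with polynomial coefficients

bound-growth : (ρ ℓ α β δ : Poly) → Poly
bound-growth ρ ℓ α β δ = ρ ⁺ ⊗ ℓ ⊗ α ⁺ ⊕ ⊖ (ρ ⁺ ⊗ β ⁺ ⊗ ρ) ⊕ ⊖ (δ ⁺ ⊗ ℓ ⊗ ℓ ⁺)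

quartic-coeffs : (ρ ℓ α β δ : Poly) → List Poly
quartic-coeffs ρ ℓ α β δ =
    β ⊗ α ⁺ ⊗ ρ ⊗ ρ ⊗ ρ ⊗ ℓ ⊕ ⊖ (β ⊗ β ⁺ ⊗ ρ ⊗ ρ ⊗ ρ ⊗ ρ)
      ⊕ ⊖ (δ ⁺ ⊗ α ⊗ ρ ⊗ ℓ ⊗ ℓ ⊗ ℓ) ⊕ δ ⁺ ⊗ δ ⊗ ℓ ⊗ ℓ ⊗ ℓ ⊗ ℓ
  ∷ β ⊗ α ⁺ ⊗ ρ ⊗ ρ ⊗ ρ ⊕ ⊖ (# 3 ⊗ δ ⁺ ⊗ α ⊗ ρ ⊗ ℓ ⊗ ℓ) ⊕ # 4 ⊗ δ ⁺ ⊗ δ ⊗ ℓ ⊗ ℓ ⊗ ℓ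
  ∷ # 6 ⊗ δ ⁺ ⊗ δ ⊗ ℓ ⊗ ℓ ⊕ ⊖ (# 3 ⊗ δ ⁺ ⊗ α ⊗ ρ ⊗ ℓ)
  ∷ # 4 ⊗ δ ⁺ ⊗ δ ⊗ ℓ ⊕ ⊖ (δ ⁺ ⊗ α ⊗ ρ)
  ∷ δ ⁺ ⊗ δ
  ∷ []

ratio-bound⇒pos : ∀ {ℓ ρ b c} → 0ℚ ℚ.< ℓ → 0ℚ ℚ.< ρ → 0ℚ ℚ.< b → ℓ * b ℚ.≤ ρ * c → 0ℚ ℚ.< c
ratio-bound⇒pos 0<ℓ 0<ρ 0<b ℓb≤ρc = *-cancelˡ-pos 0<ρ (<-≤-trans (*-pos 0<ℓ 0<b) ℓb≤ρc)

ratio-bound-step : ∀ ρ ℓ α β δ {t b c d} →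
  0ℚ ℚ.< eval (δ ⁺ ⊗ ℓ) t → 0ℚ ℚ.≤ eval (ρ ⁺ ⊗ β ⁺) t → 0ℚ ℚ.≤ eval (bound-growth ρ ℓ α β δ) t →
  eval (δ ⁺) t * d ≡ eval (α ⁺) t * c - eval (β ⁺) t * b →
  0ℚ ℚ.≤ c → eval ℓ t * b ℚ.≤ eval ρ t * c → eval (ℓ ⁺) t * c ℚ.≤ eval (ρ ⁺) t * d
ratio-bound-step ρ ℓ α β δ {t} {b} {c} {d} 0<δ′ℓ 0≤ρ′β′ 0≤growth rec 0≤c ℓb≤ρc =
  0≤q-p⇒p≤q (*-cancelˡ-nonNeg 0<δ′ℓ (subst (0ℚ ℚ.≤_) (sym expand)
    (+-nonNeg (*-nonNeg 0≤growth 0≤c) (*-nonNeg 0≤ρ′β′ (p≤q⇒0≤q-p ℓb≤ρc)))))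
  where
  open ≡-Reasoning
  ρ₀ = eval ρ t ; ℓ₀ = eval ℓ t
  ρ₁ = eval (ρ ⁺) t ; ℓ₁ = eval (ℓ ⁺) t
  α₁ = eval (α ⁺) t ; β₁ = eval (β ⁺) t ; δ₁ = eval (δ ⁺) t
  expand : δ₁ * ℓ₀ * (ρ₁ * d - ℓ₁ * c) ≡
           eval (bound-growth ρ ℓ α β δ) t * c + ρ₁ * β₁ * (ρ₀ * c - ℓ₀ * b)
  expand = begin
    δ₁ * ℓ₀ * (ρ₁ * d - ℓ₁ * c)                   ≡⟨ lemma₁ δ₁ ℓ₀ ρ₁ ℓ₁ c d ⟩
    ρ₁ * ℓ₀ * (δ₁ * d) - δ₁ * ℓ₀ * ℓ₁ * c         ≡⟨ cong (λ x → ρ₁ * ℓ₀ * x - δ₁ * ℓ₀ * ℓ₁ * c) rec ⟩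
    ρ₁ * ℓ₀ * (α₁ * c - β₁ * b) - δ₁ * ℓ₀ * ℓ₁ * c ≡⟨ lemma₂ ρ₀ ℓ₀ ρ₁ ℓ₁ α₁ β₁ δ₁ b c ⟩
    eval (bound-growth ρ ℓ α β δ) t * c + ρ₁ * β₁ * (ρ₀ * c - ℓ₀ * b) ∎
    where
    lemma₁ : ∀ δ₁ ℓ₀ ρ₁ ℓ₁ c d → δ₁ * ℓ₀ * (ρ₁ * d - ℓ₁ * c) ≡ ρ₁ * ℓ₀ * (δ₁ * d) - δ₁ * ℓ₀ * ℓ₁ * c
    lemma₁ = solve-∀ ℚ-ring
    lemma₂ : ∀ ρ₀ ℓ₀ ρ₁ ℓ₁ α₁ β₁ δ₁ b c → ρ₁ * ℓ₀ * (α₁ * c - β₁ * b) - δ₁ * ℓ₀ * ℓ₁ * c ≡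
               (ρ₁ * ℓ₀ * α₁ - ρ₁ * β₁ * ρ₀ - δ₁ * ℓ₀ * ℓ₁) * c + ρ₁ * β₁ * (ρ₀ * c - ℓ₀ * b)
    lemma₂ = solve-∀ ℚ-ring

binary-form : List ℚ → ℚ → ℚ → ℚ
binary-form [] x y = 0ℚ
binary-form (k ∷ ks) x y = k * x ^ length ks + y * binary-form ks x y

binary-form-nonNeg : ∀ {ks x y} → All (0ℚ ℚ.≤_) ks → 0ℚ ℚ.≤ x → 0ℚ ℚ.≤ y → 0ℚ ℚ.≤ binary-form ks x y
binary-form-nonNeg [] 0≤x 0≤y = ≤-refl
binary-form-nonNeg {_ ∷ ks} {x} (0≤k ∷ 0≤ks) 0≤x 0≤y =
  +-nonNeg (*-nonNeg 0≤k (^-nonNeg (length ks))) (*-nonNeg 0≤y (binary-form-nonNeg 0≤ks 0≤x 0≤y))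
  where
  ^-nonNeg : ∀ n → 0ℚ ℚ.≤ x ^ n
  ^-nonNeg zero = <⇒≤ (positive⁻¹ 1ℚ)
  ^-nonNeg (suc n) = *-nonNeg 0≤x (^-nonNeg n)

cube-inequality : ∀ ρ ℓ α β δ {t a b c d} →
  0ℚ ℚ.< eval (ρ ⊗ ρ ⊗ ρ ⊗ ρ ⊗ δ ⁺ ⊗ β) t →
  eval δ t * c ≡ eval α t * b - eval β t * a →
  eval (δ ⁺) t * d ≡ eval (α ⁺) t * c - eval (β ⁺) t * b →
  0ℚ ℚ.≤ b → eval ℓ t * b ℚ.≤ eval ρ t * c →
  All (λ k → 0ℚ ℚ.≤ eval k t) (quartic-coeffs ρ ℓ α β δ) →
  c * c * c * a ℚ.≤ b * b * b * d
cube-inequality ρ ℓ α β δ {t} {a} {b} {c} {d} 0<w rec₀ rec₁ 0≤b ℓb≤ρc 0≤coeffs =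
  0≤q-p⇒p≤q (*-cancelˡ-nonNeg 0<w (subst (0ℚ ℚ.≤_) (sym expand)
    (binary-form-nonNeg (All.map⁺ 0≤coeffs) 0≤b (p≤q⇒0≤q-p ℓb≤ρc))))
  where
  open ≡-Reasoning
  ρ₀ = eval ρ t ; ℓ₀ = eval ℓ t ; α₀ = eval α t ; β₀ = eval β t ; δ₀ = eval δ t
  α₁ = eval (α ⁺) t ; β₁ = eval (β ⁺) t ; δ₁ = eval (δ ⁺) t
  β₀a≡ : β₀ * a ≡ α₀ * b - δ₀ * c
  β₀a≡ = trans (lemma α₀ β₀ a b) (cong (λ x → α₀ * b - x) (sym rec₀))
    where
    lemma : ∀ α₀ β₀ a b → β₀ * a ≡ α₀ * b - (α₀ * b - β₀ * a)
    lemma = solve-∀ ℚ-ring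
  expand : eval (ρ ⊗ ρ ⊗ ρ ⊗ ρ ⊗ δ ⁺ ⊗ β) t * (b * b * b * d - c * c * c * a) ≡
           binary-form (map (λ k → eval k t) (quartic-coeffs ρ ℓ α β δ)) b (ρ₀ * c - ℓ₀ * b)
  expand = begin
    ρ₀ * ρ₀ * ρ₀ * ρ₀ * δ₁ * β₀ * (b * b * b * d - c * c * c * a)
      ≡⟨ lemma₁ ρ₀ δ₁ β₀ a b c d ⟩
    ρ₀ * ρ₀ * ρ₀ * ρ₀ * (β₀ * (b * b * b) * (δ₁ * d) - δ₁ * (c * c * c) * (β₀ * a))
      ≡⟨ cong₂ (λ x y → ρ₀ * ρ₀ * ρ₀ * ρ₀ * (β₀ * (b * b * b) * x - δ₁ * (c * c * c) * y)) rec₁ β₀a≡ ⟩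
    ρ₀ * ρ₀ * ρ₀ * ρ₀ * (β₀ * (b * b * b) * (α₁ * c - β₁ * b) - δ₁ * (c * c * c) * (α₀ * b - δ₀ * c))
      ≡⟨ lemma₂ ρ₀ ℓ₀ α₀ β₀ δ₀ α₁ β₁ δ₁ b c ⟩
    binary-form (map (λ k → eval k t) (quartic-coeffs ρ ℓ α β δ)) b (ρ₀ * c - ℓ₀ * b) ∎
    where
    lemma₁ : ∀ ρ₀ δ₁ β₀ a b c d → ρ₀ * ρ₀ * ρ₀ * ρ₀ * δ₁ * β₀ * (b * b * b * d - c * c * c * a) ≡
               ρ₀ * ρ₀ * ρ₀ * ρ₀ * (β₀ * (b * b * b) * (δ₁ * d) - δ₁ * (c * c * c) * (β₀ * a))
    lemma₁ = solve-∀ ℚ-ring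
    -- the powers of b are spelled out as _^_ unfolds, since the solver does not know _^_
    lemma₂ : ∀ ρ₀ ℓ₀ α₀ β₀ δ₀ α₁ β₁ δ₁ b c →
      let e = ρ₀ * c - ℓ₀ * b ; b⁰ = 1ℚ ; b¹ = b * b⁰ ; b² = b * b¹ ; b³ = b * b² ; b⁴ = b * b³ in
      ρ₀ * ρ₀ * ρ₀ * ρ₀ * (β₀ * (b * b * b) * (α₁ * c - β₁ * b) - δ₁ * (c * c * c) * (α₀ * b - δ₀ * c)) ≡
        (β₀ * α₁ * ρ₀ * ρ₀ * ρ₀ * ℓ₀ - β₀ * β₁ * ρ₀ * ρ₀ * ρ₀ * ρ₀
           - δ₁ * α₀ * ρ₀ * ℓ₀ * ℓ₀ * ℓ₀ + δ₁ * δ₀ * ℓ₀ * ℓ₀ * ℓ₀ * ℓ₀) * b⁴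
      + e * ((β₀ * α₁ * ρ₀ * ρ₀ * ρ₀ - ⟦ 3 ⟧ * δ₁ * α₀ * ρ₀ * ℓ₀ * ℓ₀
                + ⟦ 4 ⟧ * δ₁ * δ₀ * ℓ₀ * ℓ₀ * ℓ₀) * b³
      + e * ((⟦ 6 ⟧ * δ₁ * δ₀ * ℓ₀ * ℓ₀ - ⟦ 3 ⟧ * δ₁ * α₀ * ρ₀ * ℓ₀) * b²
      + e * ((⟦ 4 ⟧ * δ₁ * δ₀ * ℓ₀ - δ₁ * α₀ * ρ₀) * b¹
      + e * (δ₁ * δ₀ * b⁰ + e * 0ℚ))))
    lemma₂ = solve-∀ ℚ-ring

c³a≤b³d⇒ratio-log-convex : ∀ {a b c d} → 0ℚ ℚ.< a → 0ℚ ℚ.< b → 0ℚ ℚ.< c →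
  c * c * c * a ℚ.≤ b * b * b * d → (c /' b) * (c /' b) ℚ.≤ (b /' a) * (d /' c)
c³a≤b³d⇒ratio-log-convex {a} {b} {c} {d} 0<a 0<b 0<c c³a≤b³d =
  *-cancelʳ-≤-pos r {{positive 0<r}} (begin
    (c /' b) * (c /' b) * r                 ≡⟨ lemma₁ (c /' b) a b c ⟩
    (c /' b * b) * (c /' b * b) * c * a     ≡⟨ cong (λ x → x * x * c * a) (x/'y*y≡x c 0<b) ⟩
    c * c * c * a                           ≤⟨ c³a≤b³d ⟩
    b * b * b * d                           ≡⟨ cong₂ (λ x y → x * b * b * y) (x/'y*y≡x b 0<a) (x/'y*y≡x d 0<c) ⟨
    (b /' a * a) * b * b * (d /' c * c)     ≡⟨ lemma₂ (b /' a) (d /' c) a b c ⟨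
    (b /' a) * (d /' c) * r                 ∎)
  where
  open ≤-Reasoning
  r = a * b * b * c
  0<r : 0ℚ ℚ.< r
  0<r = *-pos (*-pos (*-pos 0<a 0<b) 0<b) 0<c
  lemma₁ : ∀ u a b c → u * u * (a * b * b * c) ≡ (u * b) * (u * b) * c * a
  lemma₁ = solve-∀ ℚ-ring
  lemma₂ : ∀ v w a b c → v * w * (a * b * b * c) ≡ (v * a) * b * b * (w * c)
  lemma₂ = solve-∀ ℚ-ring

-- The Fennessey-Larcombe-French sequence

δₚ αₚ βₚ ρₚ ℓₚ : Poly
δₚ = (X ⊕ ⊖ # 1) ⊗ X ⊗ X
αₚ = # 8 ⊗ (X ⊕ ⊖ # 1) ⊗ (# 3 ⊗ X ⊗ X ⊕ ⊖ X ⊕ ⊖ # 1)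
βₚ = # 128 ⊗ (X ⊕ ⊖ # 2) ⊗ X ⊗ X
ρₚ = X ⊗ X ⊗ X ⊗ X
ℓₚ = # 16 ⊗ ρₚ ⊕ # 16 ⊗ X ⊕ # 48

V-rec : ∀ m →
  eval δₚ ⟦ 2 ℕ.+ m ⟧ * V (2 ℕ.+ m) ≡ eval αₚ ⟦ 2 ℕ.+ m ⟧ * V (suc m) - eval βₚ ⟦ 2 ℕ.+ m ⟧ * V m
V-rec m = begin
  eval δₚ n * V (2 ℕ.+ m)             ≡⟨ cong (λ x → x * n * n * V (2 ℕ.+ m)) n-1≡ ⟩
  ⟦ suc m ⟧ * n * n * V (2 ℕ.+ m)     ≡⟨ *-comm _ (V (2 ℕ.+ m)) ⟩
  V (2 ℕ.+ m) * (⟦ suc m ⟧ * n * n)   ≡⟨ x/'y*y≡x _ 0<denominator ⟩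
  ⟦ 8 ⟧ * ⟦ suc m ⟧ * (⟦ 3 ⟧ * n * n - n - 1ℚ) * V (suc m) - ⟦ 128 ⟧ * ⟦ m ⟧ * n * n * V m
    ≡⟨ cong₂ (λ x y → ⟦ 8 ⟧ * x * (⟦ 3 ⟧ * n * n - n - 1ℚ) * V (suc m) - ⟦ 128 ⟧ * y * n * n * V m)
             (sym n-1≡) (sym n-2≡) ⟩
  eval αₚ n * V (suc m) - eval βₚ n * V m ∎
  where
  open ≡-Reasoning
  n = ⟦ 2 ℕ.+ m ⟧
  n-1≡ : n - ⟦ 1 ⟧ ≡ ⟦ suc m ⟧
  n-1≡ = ⟦m+n⟧-⟦m⟧≡⟦n⟧ 1 (suc m)
  n-2≡ : n - ⟦ 2 ⟧ ≡ ⟦ m ⟧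
  n-2≡ = ⟦m+n⟧-⟦m⟧≡⟦n⟧ 2 m
  0<denominator : 0ℚ ℚ.< ⟦ suc m ⟧ * n * n
  0<denominator = subst (λ x → 0ℚ ℚ.< x * n * n) n-1≡ (pos-beyond 2 δₚ m)

V-rec⁺ : ∀ m →
  eval (δₚ ⁺) ⟦ suc m ⟧ * V (2 ℕ.+ m) ≡ eval (αₚ ⁺) ⟦ suc m ⟧ * V (suc m) - eval (βₚ ⁺) ⟦ suc m ⟧ * V m
V-rec⁺ m = subst (λ t → eval δₚ t * V (2 ℕ.+ m) ≡ eval αₚ t * V (suc m) - eval βₚ t * V m)
                 (⟦+⟧ 1 (suc m)) (V-rec m)

RatioBound : ℕ → Set
RatioBound n = eval ℓₚ ⟦ n ⟧ * V (n ∸ 1) ℚ.≤ eval ρₚ ⟦ n ⟧ * V n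

ratio-bound-next : ∀ k → 0ℚ ℚ.≤ V (4 ℕ.+ k) → RatioBound (4 ℕ.+ k) → RatioBound (5 ℕ.+ k)
ratio-bound-next k 0≤V bound =
  subst (λ t → eval ℓₚ t * V (4 ℕ.+ k) ℚ.≤ eval ρₚ t * V (5 ℕ.+ k)) (sym (⟦+⟧ 1 (4 ℕ.+ k)))
    (ratio-bound-step ρₚ ℓₚ αₚ βₚ δₚ {t = ⟦ 4 ℕ.+ k ⟧}
      (pos-beyond 4 (δₚ ⁺ ⊗ ℓₚ) k)
      (nonNeg-beyond 4 (ρₚ ⁺ ⊗ βₚ ⁺) k)
      (nonNeg-beyond 4 (bound-growth ρₚ ℓₚ αₚ βₚ δₚ) k)
      (V-rec⁺ (3 ℕ.+ k)) 0≤V bound)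

V-ratio-bound : ∀ k → 0ℚ ℚ.< V (3 ℕ.+ k) × RatioBound (4 ℕ.+ k)
V-ratio-bound zero = from-yes (0ℚ <? V 3) , from-yes (eval ℓₚ ⟦ 4 ⟧ * V 3 ≤? eval ρₚ ⟦ 4 ⟧ * V 4)
V-ratio-bound (suc k) = 0<V′ , ratio-bound-next k (<⇒≤ 0<V′) bound
  where
  bound : RatioBound (4 ℕ.+ k)
  bound = proj₂ (V-ratio-bound k)
  0<V′ : 0ℚ ℚ.< V (4 ℕ.+ k)
  0<V′ = ratio-bound⇒pos (pos-beyond 4 ℓₚ k) (pos-beyond 4 ρₚ k) (proj₁ (V-ratio-bound k)) bound

V-pos : ∀ n → 0ℚ ℚ.< V n
V-pos 0 = from-yes (0ℚ <? V 0)
V-pos 1 = from-yes (0ℚ <? V 1)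
V-pos 2 = from-yes (0ℚ <? V 2)
V-pos (suc (suc (suc k))) = proj₁ (V-ratio-bound k)

V-cube-inequality : ∀ k →
  V (4 ℕ.+ k) * V (4 ℕ.+ k) * V (4 ℕ.+ k) * V (2 ℕ.+ k)
    ℚ.≤ V (3 ℕ.+ k) * V (3 ℕ.+ k) * V (3 ℕ.+ k) * V (5 ℕ.+ k)
V-cube-inequality k = cube-inequality ρₚ ℓₚ αₚ βₚ δₚ {t = ⟦ 4 ℕ.+ k ⟧}
  (pos-beyond 4 (ρₚ ⊗ ρₚ ⊗ ρₚ ⊗ ρₚ ⊗ δₚ ⁺ ⊗ βₚ) k)
  (V-rec (2 ℕ.+ k))
  (V-rec⁺ (3 ℕ.+ k))
  (<⇒≤ (V-pos (3 ℕ.+ k)))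
  (proj₂ (V-ratio-bound k))
  (all-nonNeg-beyond 4 (quartic-coeffs ρₚ ℓₚ αₚ βₚ δₚ) k)

theorem1p3 : ∀ (n : ℕ) → 3 ≤ n →
    ((V n /' V (n ∸ 1)) * (V n /' V (n ∸ 1)))
      ℚ.≤ ((V (n ∸ 1) /' V (n ∸ 2)) * (V (suc n) /' V n))
theorem1p3 1 (s≤s ())
theorem1p3 2 (s≤s (s≤s ()))
theorem1p3 3 _ = from-yes ((V 3 /' V 2) * (V 3 /' V 2) ≤? (V 2 /' V 1) * (V 4 /' V 3))
theorem1p3 (suc (suc (suc (suc k)))) _ =
  c³a≤b³d⇒ratio-log-convex (V-pos (2 ℕ.+ k)) (V-pos (3 ℕ.+ k)) (V-pos (4 ℕ.+ k)) (V-cube-inequality k)
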